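{- Let $G$ be an $st$-fan and let $uv\neq st$ be an outer edge of $G$. Then $G$ admits a $2$-page $uv$-consecutive upward book embedding.
   Context: An $st$-DAG is a DAG with exactly one source $s$ and one sink $t$. A fan is an outerplanar graph that is biconnected, whose inner faces (in its outerplanar embedding) are all triangles, whose weak dual (one node per inner face, adjacent when faces share an edge) is a path, and whose inner edges all share a common endpoint. An $st$-fan is an $st$-DAG whose underlying graph is a fan and whose inner edges all have $s$ as an endpoint. Outer edges are edges on the outer face. A $k$-page upward book embedding of a DAG $G=(V,E)$ is a pair $\langle \pi,\sigma\rangle$ where $\pi\colon V\to\{1,\dots,|V|\}$ is a bijection with $\pi(u)<\pi(v)$ for every directed edge $uv$, and $\sigma\colon E\to\{1,\dots,k\}$ is such that no two edges with the same page cross; edges $uv,wx$ with $\pi(u)<\pi(v)$, $\pi(w)<\pi(x)$, $\pi(u)<\pi(w)$ cross if $\pi(u)<\pi(w)<\pi(v)<\pi(x)$. For an $st$-DAG $G$ and an edge $uv\ne st$, an upward book embedding $\langle\pi,\sigma\rangle$ is $uv$-consecutive if (i) $u$ and $v$ are consecutive in $\pi$, (ii) all edges incident to $s$ are on one page, and (iii) all edges incident to $t$ are on at most two pages. -}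

module Defs where

open import Data.Nat using (ℕ; zero; suc; _≤_; _∸_)
open import Data.Fin using (Fin; toℕ) renaming (_<_ to _<ᶠ_)
open import Data.Product using (Σ; ∃; _×_; _,_)
open import Data.Sum using (_⊎_)
open import Relation.Binary.PropositionalEquality using (_≡_; _≢_)
open import Relation.Nullary using (¬_)
open import Relation.Binary.Construct.Closure.Transitive using (TransClosure)
open import Function.Bundles using (_⇔_; _↔_; Inverse)
open import Function.Definitions using (Injective)

Digraph : ℕ → Set₁
Digraph N = Fin N → Fin N → Set

Acyclic : ∀ {N} → Digraph N → Set
Acyclic E = ∀ v → ¬ TransClosure E v v

IsSource : ∀ {N} → Digraph N → Fin N → Set
IsSource E v = ∀ w → ¬ E w v

IsSink : ∀ {N} → Digraph N → Fin N → Set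
IsSink E v = ∀ w → ¬ E v w

IsSTDAG : ∀ {N} → Digraph N → Fin N → Fin N → Set
IsSTDAG E s t =
  Acyclic E × (∀ v → IsSource E v ⇔ v ≡ s) × (∀ v → IsSink E v ⇔ v ≡ t)

Adj : ∀ {N} → Digraph N → Fin N → Fin N → Set
Adj E u v = E u v ⊎ E v u

RimNext : ∀ {m} → Fin m → Fin m → Set
RimNext i j = toℕ j ≡ suc (toℕ i)

FanAdj : ∀ {N m} → Fin N → (Fin m → Fin N) → Fin N → Fin N → Set
FanAdj {m = m} c rim u v =
    (u ≡ c × ∃ λ i → v ≡ rim i)
  ⊎ (v ≡ c × ∃ λ i → u ≡ rim i)
  ⊎ (∃ λ i → ∃ λ j → RimNext {m} i j ×
       ((u ≡ rim i × v ≡ rim j) ⊎ (u ≡ rim j × v ≡ rim i)))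

-- Edges on the outer face of that fan: the two extreme spokes c–rim 0,
-- c–rim (m-1), and all rim edges.
FanOuterAdj : ∀ {N m} → Fin N → (Fin m → Fin N) → Fin N → Fin N → Set
FanOuterAdj {m = m} c rim u v =
    (u ≡ c × ∃ λ i → (toℕ i ≡ 0 ⊎ suc (toℕ i) ≡ m) × v ≡ rim i)
  ⊎ (v ≡ c × ∃ λ i → (toℕ i ≡ 0 ⊎ suc (toℕ i) ≡ m) × u ≡ rim i)
  ⊎ (∃ λ i → ∃ λ j → RimNext {m} i j ×
       ((u ≡ rim i × v ≡ rim j) ⊎ (u ≡ rim j × v ≡ rim i)))

record FanWithApex {N : ℕ} (E : Digraph N) (c : Fin N) : Set where
  field
    m      : ℕ
    2≤m    : 2 ≤ m
    rim    : Fin m → Fin N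
    rim-injective : Injective _≡_ _≡_ rim
    rim≢c  : ∀ i → rim i ≢ c
    covers : ∀ v → v ≢ c → ∃ λ i → rim i ≡ v
    adj    : ∀ u v → Adj E u v ⇔ FanAdj c rim u v

-- st-fan: an st-DAG whose underlying graph is a fan whose inner edges all
-- have s as an endpoint (i.e. a fan with apex s)
record IsSTFan {N : ℕ} (E : Digraph N) (s t : Fin N) : Set where
  field
    stdag : IsSTDAG E s t
    fan   : FanWithApex E s

OuterEdge : ∀ {N} {E : Digraph N} {s t : Fin N} → IsSTFan E s t →
            Fin N → Fin N → Set
OuterEdge {E = E} {s} F u v =
  E u v × FanOuterAdj s (FanWithApex.rim (IsSTFan.fan F)) u v

-- k-page upward book embedding ⟨π, σ⟩; σ u v is the page of edge uv.
record UpwardBookEmbedding {N : ℕ} (E : Digraph N) (k : ℕ) : Set where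
  field
    π      : Fin N ↔ Fin N
    σ      : Fin N → Fin N → Fin k
  ord : Fin N → ℕ
  ord v = toℕ (Inverse.to π v)
  field
    upward : ∀ u v → E u v → ord u Data.Nat.< ord v
    noCrossing : ∀ u v w x → E u v → E w x → σ u v ≡ σ w x →
      ¬ (ord u Data.Nat.< ord w × ord w Data.Nat.< ord v × ord v Data.Nat.< ord x)

IsConsecutive : ∀ {N k} {E : Digraph N} → Fin N → Fin N →
                UpwardBookEmbedding E k → Fin N → Fin N → Set
IsConsecutive {N} {k} {E} s t B u v =
    (suc (ord u) ≡ ord v ⊎ suc (ord v) ≡ ord u)
  × (∃ λ p → ∀ x y → E x y → (x ≡ s ⊎ y ≡ s) → σ x y ≡ p)
  × (∃ λ p → ∃ λ q → ∀ x y → E x y → (x ≡ t ⊎ y ≡ t) → (σ x y ≡ p ⊎ σ x y ≡ q))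
  where open UpwardBookEmbedding B

-- Let t = rim k.  Since s is the only source and t the only sink, every rim
-- edge points towards t.  Hence in the order
--   s, rim 0, …, rim (k-1), rim (m-1), …, rim (k+1), t
-- every edge avoiding s and t joins consecutive vertices, and two pages suffice:
-- the edges into t on one, everything else on the other.  This order makes
-- s rim 0, rim (k+1) t and the rim edges not into t consecutive; the remaining
-- outer edges, s rim (m-1) and rim (k-1) t, are consecutive in the same order
-- built from the reversed rim.
module Submission where

open import Defs
open import Data.Nat using (ℕ; zero; suc; _+_; _∸_; _≤_; _<_; z≤n; s≤s; s≤s⁻¹; _≤?_)
open import Data.Nat.Properties
open import Data.Fin using (Fin; toℕ; fromℕ<; opposite) renaming (_≟_ to _≟ᶠ_)
open import Data.Fin.Patterns using (0F; 1F)
open import Data.Fin.Properties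
  using (toℕ-injective; toℕ-fromℕ<; toℕ-cast; toℕ<n; opposite-prop; opposite-involutive)
open import Data.Fin.Permutation
  using (Permutation; Permutation′; permutation; _⟨$⟩ʳ_; _⟨$⟩ˡ_; inverseˡ; _∘ₚ_; cast-id; ↔⇒≡)
open import Data.Product using (_×_; Σ; ∃; _,_; proj₁; proj₂)
open import Data.Sum using (_⊎_; inj₁; inj₂)
open import Data.Empty using (⊥-elim)
open import Function using (_∘_)
open import Function.Bundles using (Equivalence; mk⇔)
open import Relation.Binary.PropositionalEquality
open import Relation.Nullary using (¬_; yes; no)
open import Relation.Binary.Construct.Closure.Transitive using ([_]; _∷_)

reverseAbove : ℕ → ℕ → ℕ → ℕ
reverseAbove k n p with p ≤? k
... | yes _ = p
... | no _  = k + suc n ∸ p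

module _ {k n : ℕ} where

  reverseAbove-≤ : ∀ {p} → p ≤ k → reverseAbove k n p ≡ p
  reverseAbove-≤ {p} p≤k with p ≤? k
  ... | yes _   = refl
  ... | no p≰k = ⊥-elim (p≰k p≤k)

  reverseAbove-> : ∀ {p} → k < p → reverseAbove k n p ≡ k + suc n ∸ p
  reverseAbove-> {p} k<p with p ≤? k
  ... | yes p≤k = ⊥-elim (<⇒≱ k<p p≤k)
  ... | no _    = refl

  private
    k+1+n∸[1+k]≡n : k + suc n ∸ suc k ≡ n
    k+1+n∸[1+k]≡n = trans (cong (_∸ suc k) (+-suc k n)) (m+n∸m≡n (suc k) n)

    reflected-≤ : ∀ {p} → k < p → k + suc n ∸ p ≤ n
    reflected-≤ k<p = ≤-trans (∸-monoʳ-≤ (k + suc n) k<p) (≤-reflexive k+1+n∸[1+k]≡n)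

    reflected-> : ∀ {p} → p ≤ n → k < k + suc n ∸ p
    reflected-> {p} p≤n = subst (k <_) (sym (+-∸-assoc k (m≤n⇒m≤1+n p≤n)))
                                (m<m+n k (m<n⇒0<n∸m (s≤s p≤n)))

  reverseAbove-< : ∀ {p} → p < suc n → reverseAbove k n p < suc n
  reverseAbove-< {p} p<1+n with p ≤? k
  ... | yes _   = p<1+n
  ... | no p≰k = s≤s (reflected-≤ (≰⇒> p≰k))

  reverseAbove-involutive : ∀ {p} → p < suc n → reverseAbove k n (reverseAbove k n p) ≡ p
  reverseAbove-involutive {p} p<1+n with p ≤? k
  ... | yes p≤k = reverseAbove-≤ p≤k
  ... | no p≰k  = trans (reverseAbove-> (reflected-> (s≤s⁻¹ p<1+n)))
                        (m∸[m∸n]≡n (≤-trans (<⇒≤ p<1+n) (m≤n+m (suc n) k)))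

  reverseAbove-1+k : reverseAbove k n (suc k) ≡ n
  reverseAbove-1+k = trans (reverseAbove-> (n<1+n k)) k+1+n∸[1+k]≡n

  reverseAbove-suc : ∀ {p} → k < p → p < n → suc (reverseAbove k n (suc p)) ≡ reverseAbove k n p
  reverseAbove-suc {p} k<p p<n = begin
    suc (reverseAbove k n (suc p)) ≡⟨ cong suc (reverseAbove-> (m<n⇒m<1+n k<p)) ⟩
    suc (k + suc n ∸ suc p)        ≡⟨ +-∸-assoc 1 p<k+1+n ⟨
    k + suc n ∸ p                  ≡⟨ reverseAbove-> k<p ⟨
    reverseAbove k n p             ∎
    where
    open ≡-Reasoning
    p<k+1+n : p < k + suc n
    p<k+1+n = ≤-trans (m<n⇒m<1+n p<n) (m≤n+m (suc n) k)

module _ {n : ℕ} (f : ℕ → ℕ) (f-< : ∀ {p} → p < n → f p < n)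
         (f-involutive : ∀ {p} → p < n → f (f p) ≡ p) where

  involution⇒permutation : Permutation′ n
  involution⇒permutation = permutation f′ f′ f′-involutive f′-involutive
    where
    f′ : Fin n → Fin n
    f′ i = fromℕ< (f-< (toℕ<n i))
    f′-involutive : ∀ i → f′ (f′ i) ≡ i
    f′-involutive i = toℕ-injective (trans (toℕ-fromℕ< _)
      (trans (cong f (toℕ-fromℕ< _)) (f-involutive (toℕ<n i))))

  toℕ-involution⇒permutation : ∀ i → toℕ (involution⇒permutation ⟨$⟩ʳ i) ≡ f (toℕ i)
  toℕ-involution⇒permutation i = toℕ-fromℕ< _

module _ {N : ℕ} {E : Digraph N} {s t : Fin N} (dag : IsSTDAG E s t) where

  source-s : IsSource E s
  source-s = Equivalence.from (proj₁ (proj₂ dag) s) refl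

  sink-t : IsSink E t
  sink-t = Equivalence.from (proj₂ (proj₂ dag) t) refl

  sink⇒t : ∀ {v} → IsSink E v → v ≡ t
  sink⇒t {v} = Equivalence.to (proj₂ (proj₂ dag) v)

  no-2-cycle : ∀ {x y} → E x y → ¬ E y x
  no-2-cycle {x} e e′ = proj₁ dag x (e ∷ [ e′ ])

HasConsecutiveEmbedding : ∀ {N} → Digraph N → (s t u v : Fin N) → Set
HasConsecutiveEmbedding E s t u v = Σ (UpwardBookEmbedding E 2) λ B → IsConsecutive s t B u v

record STLayout {N : ℕ} (E : Digraph N) (s t : Fin N) : Set where
  field
    order : Permutation′ N
  pos : Fin N → ℕ
  pos v = toℕ (order ⟨$⟩ʳ v)
  field
    pos-s : pos s ≡ 0
    pos-t : suc (pos t) ≡ N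
    short : ∀ {x y} → E x y → x ≢ s → y ≢ t → suc (pos x) ≡ pos y

  pos-injective : ∀ {x y} → pos x ≡ pos y → x ≡ y
  pos-injective {x} {y} eq = trans (sym (inverseˡ order))
    (trans (cong (order ⟨$⟩ˡ_) (toℕ-injective eq)) (inverseˡ order))

nothing-between : ∀ {a b c} → suc a ≡ c → a < b → ¬ b < c
nothing-between refl a<b b<1+a = <⇒≱ a<b (s≤s⁻¹ b<1+a)

module _ {N : ℕ} {E : Digraph N} {s t : Fin N} (dag : IsSTDAG E s t) (L : STLayout E s t) where
  open STLayout L

  -- Page 0 holds the edges out of s, which all start at the first vertex, and
  -- the short edges, which nothing can cross; page 1 holds the remaining edges,
  -- which all end at t.
  page : Fin N → Fin N → Fin 2
  page x y with x ≟ᶠ s | y ≟ᶠ t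
  ... | no _ | yes _ = 1F
  ... | _    | _     = 0F

  page-s : ∀ y → page s y ≡ 0F
  page-s y with s ≟ᶠ s
  ... | yes _  = refl
  ... | no s≢s = ⊥-elim (s≢s refl)

  page-1F : ∀ {x y} → page x y ≡ 1F → y ≡ t
  page-1F {x} {y} eq with x ≟ᶠ s | y ≟ᶠ t
  ... | no _ | yes y≡t = y≡t
  page-1F () | yes _ | _
  page-1F () | no _  | no _

  page-0F : ∀ {x y} → E x y → page x y ≡ 0F → x ≡ s ⊎ suc (pos x) ≡ pos y
  page-0F {x} {y} e eq with x ≟ᶠ s | y ≟ᶠ t
  ... | yes x≡s | _     = inj₁ x≡s
  ... | no x≢s  | no y≢t = inj₂ (short e x≢s y≢t)
  page-0F e () | no _ | yes _

  below-t : ∀ {x} → x ≢ t → pos x < pos t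
  below-t {x} x≢t =
    ≤∧≢⇒< (s≤s⁻¹ (subst (pos x <_) (sym pos-t) (toℕ<n _))) (x≢t ∘ pos-injective)

  upward : ∀ x y → E x y → pos x < pos y
  upward x y e with x ≟ᶠ s | y ≟ᶠ t
  ... | yes refl | _ = subst (_< pos y) (sym pos-s) (n≢0⇒n>0 λ pos-y≡0 →
    source-s dag s (subst (E s) (pos-injective (trans pos-y≡0 (sym pos-s))) e))
  ... | no _    | yes refl = below-t λ { refl → sink-t dag t e }
  ... | no x≢s  | no y≢t   = ≤-reflexive (short e x≢s y≢t)

  no-crossing : ∀ u v w x → E u v → E w x → page u v ≡ page w x →
                ¬ (pos u < pos w × pos w < pos v × pos v < pos x)
  no-crossing u v w x e e′ same (u<w , w<v , v<x) with page u v in eq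
  ... | 1F = <-irrefl (cong pos (trans (page-1F {u} eq) (sym (page-1F {w} (sym same))))) v<x
  ... | 0F with page-0F e eq | page-0F e′ (sym same)
  ...   | inj₂ uv-short | _             = nothing-between uv-short u<w w<v
  ...   | inj₁ refl     | inj₁ refl     = <-irrefl refl u<w
  ...   | inj₁ refl     | inj₂ wx-short = nothing-between wx-short w<v v<x

  embedding : UpwardBookEmbedding E 2
  embedding = record { π = order ; σ = page ; upward = upward ; noCrossing = no-crossing }

  consecutiveEmbedding : ∀ {u v} → suc (pos u) ≡ pos v → HasConsecutiveEmbedding E s t u v
  consecutiveEmbedding adjacent =
    embedding , inj₁ adjacent , (0F , edges-at-s-on-0F) , (0F , 1F , two-pages)
    where
    edges-at-s-on-0F : ∀ x y → E x y → x ≡ s ⊎ y ≡ s → page x y ≡ 0F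
    edges-at-s-on-0F x y _ (inj₁ refl) = page-s y
    edges-at-s-on-0F x y e (inj₂ refl) = ⊥-elim (source-s dag x e)
    two-pages : ∀ x y → E x y → x ≡ t ⊎ y ≡ t → page x y ≡ 0F ⊎ page x y ≡ 1F
    two-pages x y _ _ with page x y
    ... | 0F = inj₁ refl
    ... | 1F = inj₂ refl

RimNext-opposite : ∀ {m} {i j : Fin m} → RimNext i j → RimNext (opposite j) (opposite i)
RimNext-opposite {m} {i} {j} i→j = begin
  toℕ (opposite i)       ≡⟨ opposite-prop i ⟩
  m ∸ suc (toℕ i)        ≡⟨ cong (m ∸_) i→j ⟨
  m ∸ toℕ j              ≡⟨ +-∸-assoc 1 (toℕ<n j) ⟩
  suc (m ∸ suc (toℕ j))  ≡⟨ cong suc (opposite-prop j) ⟨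
  suc (toℕ (opposite j)) ∎
  where open ≡-Reasoning

opposite-reflects-≤ : ∀ {m} {i j : Fin m} →
                      toℕ (opposite i) ≤ toℕ (opposite j) → toℕ j ≤ toℕ i
opposite-reflects-≤ {m} {i} {j} le = s≤s⁻¹ (∸-cancelʳ-≤ (toℕ<n j)
  (subst₂ _≤_ (opposite-prop i) (opposite-prop j) le))

opposite²-invariant : ∀ {A : Set} {m} (f : Fin m → A) i → f i ≡ f (opposite (opposite i))
opposite²-invariant f i = cong f (sym (opposite-involutive i))

module _ {N m : ℕ} {c : Fin N} {rim : Fin m → Fin N} where

  private
    rim² : ∀ i → rim i ≡ rim (opposite (opposite i))
    rim² = opposite²-invariant rim

  FanAdj-reverse : ∀ {u v} → FanAdj c rim u v → FanAdj c (rim ∘ opposite) u v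
  FanAdj-reverse (inj₁ (u≡c , i , v≡)) = inj₁ (u≡c , opposite i , trans v≡ (rim² i))
  FanAdj-reverse (inj₂ (inj₁ (v≡c , i , u≡))) = inj₂ (inj₁ (v≡c , opposite i , trans u≡ (rim² i)))
  FanAdj-reverse (inj₂ (inj₂ (i , j , i→j , inj₁ (u≡ , v≡)))) = inj₂ (inj₂
    (opposite j , opposite i , RimNext-opposite i→j , inj₂ (trans u≡ (rim² i) , trans v≡ (rim² j))))
  FanAdj-reverse (inj₂ (inj₂ (i , j , i→j , inj₂ (u≡ , v≡)))) = inj₂ (inj₂
    (opposite j , opposite i , RimNext-opposite i→j , inj₁ (trans u≡ (rim² j) , trans v≡ (rim² i))))

  FanAdj-unreverse : ∀ {u v} → FanAdj c (rim ∘ opposite) u v → FanAdj c rim u v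
  FanAdj-unreverse (inj₁ (u≡c , i , v≡)) = inj₁ (u≡c , opposite i , v≡)
  FanAdj-unreverse (inj₂ (inj₁ (v≡c , i , u≡))) = inj₂ (inj₁ (v≡c , opposite i , u≡))
  FanAdj-unreverse (inj₂ (inj₂ (i , j , i→j , inj₁ uv≡))) = inj₂ (inj₂
    (opposite j , opposite i , RimNext-opposite i→j , inj₂ uv≡))
  FanAdj-unreverse (inj₂ (inj₂ (i , j , i→j , inj₂ uv≡))) = inj₂ (inj₂
    (opposite j , opposite i , RimNext-opposite i→j , inj₁ uv≡))

module _ {N : ℕ} {E : Digraph N} {c : Fin N} (fan : FanWithApex E c) where
  open FanWithApex fan

  reverseFan : FanWithApex E c
  reverseFan = record
    { m = m ; 2≤m = 2≤m ; rim = rim ∘ opposite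
    ; rim-injective = opposite-injective ∘ rim-injective
    ; rim≢c = rim≢c ∘ opposite
    ; covers = λ v v≢c → let i , rim-i≡v = covers v v≢c in
        opposite i , trans (sym (opposite²-invariant rim i)) rim-i≡v
    ; adj = λ u v → mk⇔ (FanAdj-reverse ∘ Equivalence.to (adj u v))
                        (Equivalence.from (adj u v) ∘ FanAdj-unreverse)
    }
    where
    opposite-injective : ∀ {i j : Fin m} → opposite i ≡ opposite j → i ≡ j
    opposite-injective {i} {j} eq = trans (sym (opposite-involutive i))
      (trans (cong opposite eq) (opposite-involutive j))

  apexRimIndex : Fin N → Fin (suc m)
  apexRimIndex v with v ≟ᶠ c
  ... | yes _  = 0F
  ... | no v≢c = Fin.suc (proj₁ (covers v v≢c))

  apexRimVertex : Fin (suc m) → Fin N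
  apexRimVertex 0F          = c
  apexRimVertex (Fin.suc i) = rim i

  apexRimIndex-vertex : ∀ i → apexRimIndex (apexRimVertex i) ≡ i
  apexRimIndex-vertex 0F with c ≟ᶠ c
  ... | yes _  = refl
  ... | no c≢c = ⊥-elim (c≢c refl)
  apexRimIndex-vertex (Fin.suc i) with rim i ≟ᶠ c
  ... | yes rim-i≡c = ⊥-elim (rim≢c i rim-i≡c)
  ... | no rim-i≢c  = cong Fin.suc (rim-injective (proj₂ (covers (rim i) rim-i≢c)))

  apexRimVertex-index : ∀ v → apexRimVertex (apexRimIndex v) ≡ v
  apexRimVertex-index v with v ≟ᶠ c
  ... | yes v≡c = sym v≡c
  ... | no v≢c  = proj₂ (covers v v≢c)

  apexRimPermutation : Permutation N (suc m)
  apexRimPermutation =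
    permutation apexRimIndex apexRimVertex apexRimIndex-vertex apexRimVertex-index

module _ {N : ℕ} {E : Digraph N} {s t : Fin N} (dag : IsSTDAG E s t) where

  module Rim (fan : FanWithApex E s) where
    open FanWithApex fan

    spoke : ∀ i → E s (rim i)
    spoke i with Equivalence.from (adj s (rim i)) (inj₁ (refl , i , refl))
    ... | inj₁ e = e
    ... | inj₂ e = ⊥-elim (source-s dag (rim i) e)

    t≢s : t ≢ s
    t≢s refl = sink-t dag (rim first) (spoke first)
      where
      first : Fin m
      first = fromℕ< (≤-trans (s≤s z≤n) 2≤m)

    rim-edge : ∀ {x y} → E x y → x ≢ s → ∃ λ i → ∃ λ j → RimNext i j ×
               ((x ≡ rim i × y ≡ rim j) ⊎ (x ≡ rim j × y ≡ rim i))
    rim-edge {x} {y} e x≢s with Equivalence.to (adj x y) (inj₁ e)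
    ... | inj₁ (x≡s , _)         = ⊥-elim (x≢s x≡s)
    ... | inj₂ (inj₁ (refl , _)) = ⊥-elim (source-s dag x e)
    ... | inj₂ (inj₂ rim-adj)    = rim-adj

    rim-out-edge : ∀ {j w} → E (rim j) w →
                   (∃ λ b → RimNext j b × w ≡ rim b) ⊎ (∃ λ a → RimNext a j × w ≡ rim a)
    rim-out-edge {j} e with rim-edge e (rim≢c j)
    ... | a , b , a→b , inj₁ (rim-j≡rim-a , w≡rim-b) with rim-injective rim-j≡rim-a
    ...   | refl = inj₁ (b , a→b , w≡rim-b)
    rim-out-edge {j} e | a , b , a→b , inj₂ (rim-j≡rim-b , w≡rim-a) with rim-injective rim-j≡rim-b
    ...   | refl = inj₂ (a , a→b , w≡rim-a)

    rightward-edge-head-≤-t : ∀ {k i j} → rim k ≡ t → RimNext i j → E (rim i) (rim j) →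
                              toℕ j ≤ toℕ k
    rightward-edge-head-≤-t {k} {i} {j} rim-k i→j e =
      ≮⇒≥ (beyond-t (m ∸ toℕ j) (m∸n+n≡m (<⇒≤ (toℕ<n j))) i→j e)
      where
      -- Right of t, the head of a rightward edge is no sink, and its out-edge
      -- cannot turn back, so it is again rightward; n bounds how often this
      -- can happen before the rim ends.
      beyond-t : ∀ n {i j} → n + toℕ j ≡ m → RimNext i j → E (rim i) (rim j) → ¬ toℕ k < toℕ j
      beyond-t zero {j = j} j≡m _ _ _ = <-irrefl j≡m (toℕ<n j)
      beyond-t (suc n) {i} {j} 1+n+j≡m i→j e k<j =
        <-irrefl (cong toℕ (rim-injective (trans rim-k (sym (sink⇒t dag rim-j-sink))))) k<j
        where
        rim-j-sink : IsSink E (rim j)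
        rim-j-sink w e′ with rim-out-edge e′
        ... | inj₁ (b , j→b , refl) =
          beyond-t n (trans (cong (n +_) j→b) (trans (+-suc n (toℕ j)) 1+n+j≡m)) j→b e′
                     (subst (toℕ k <_) (sym j→b) (m<n⇒m<1+n k<j))
        ... | inj₂ (a , a→j , refl) with toℕ-injective (suc-injective (trans (sym i→j) a→j))
        ...   | refl = no-2-cycle dag e e′

  leftward-edge-head-≥-t : (fan : FanWithApex E s) → let open FanWithApex fan in
    ∀ {k i j} → rim k ≡ t → RimNext i j → E (rim j) (rim i) → toℕ k ≤ toℕ i
  leftward-edge-head-≥-t fan {k} {i} {j} rim-k i→j e = opposite-reflects-≤
    (Rim.rightward-edge-head-≤-t (reverseFan fan)
      (trans (sym (opposite²-invariant rim k)) rim-k) (RimNext-opposite i→j)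
      (subst₂ E (opposite²-invariant rim j) (opposite²-invariant rim i) e))
    where open FanWithApex fan

  module Layout (fan : FanWithApex E s) {k : Fin (FanWithApex.m fan)}
                (rim-k : FanWithApex.rim fan k ≡ t) where
    open FanWithApex fan
    open Rim fan

    flip : ℕ → ℕ
    flip = reverseAbove (toℕ k) m

    flip-permutation : Permutation′ (suc m)
    flip-permutation =
      involution⇒permutation flip (reverseAbove-< {toℕ k}) (reverseAbove-involutive {toℕ k})

    -- s at 0 and rim i at suc i, then the block rim k, …, rim (m-1) reversed
    order : Permutation′ N
    order = apexRimPermutation fan ∘ₚ flip-permutation
         ∘ₚ cast-id (sym (↔⇒≡ (apexRimPermutation fan)))

    pos : Fin N → ℕ
    pos v = toℕ (order ⟨$⟩ʳ v)

    pos-vertex : ∀ i → pos (apexRimVertex fan i) ≡ flip (toℕ i)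
    pos-vertex i = begin
      pos (apexRimVertex fan i)          ≡⟨ toℕ-cast _ (flip-permutation ⟨$⟩ʳ index) ⟩
      toℕ (flip-permutation ⟨$⟩ʳ index) ≡⟨ toℕ-involution⇒permutation flip
                                              (reverseAbove-< {toℕ k})
                                              (reverseAbove-involutive {toℕ k}) index ⟩
      flip (toℕ index)                   ≡⟨ cong (flip ∘ toℕ) (apexRimIndex-vertex fan i) ⟩
      flip (toℕ i)                       ∎
      where
      open ≡-Reasoning
      index : Fin (suc m)
      index = apexRimIndex fan (apexRimVertex fan i)

    pos-rim : ∀ i → pos (rim i) ≡ flip (suc (toℕ i))
    pos-rim i = pos-vertex (Fin.suc i)

    pos-s : pos s ≡ 0
    pos-s = trans (pos-vertex 0F) (reverseAbove-≤ {toℕ k} {m} z≤n)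

    pos-t : suc (pos t) ≡ N
    pos-t = begin
      suc (pos t)       ≡⟨ cong (suc ∘ pos) rim-k ⟨
      suc (pos (rim k)) ≡⟨ cong suc (trans (pos-rim k) (reverseAbove-1+k {toℕ k})) ⟩
      suc m             ≡⟨ ↔⇒≡ (apexRimPermutation fan) ⟨
      N                 ∎
      where open ≡-Reasoning

    rightward-short : ∀ {x y a b} → E x y → x ≡ rim a → y ≡ rim b → RimNext a b → y ≢ t →
                      suc (pos x) ≡ pos y
    rightward-short {a = a} {b} e refl refl a→b rim-b≢t = begin
      suc (pos (rim a)) ≡⟨ cong suc (trans (pos-rim a) (reverseAbove-≤ 1+a≤k)) ⟩
      suc (suc (toℕ a)) ≡⟨ cong suc a→b ⟨
      suc (toℕ b)       ≡⟨ trans (pos-rim b) (reverseAbove-≤ b<k) ⟨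
      pos (rim b)       ∎
      where
      open ≡-Reasoning
      b<k : toℕ b < toℕ k
      b<k = ≤∧≢⇒< (rightward-edge-head-≤-t rim-k a→b e)
                  (λ b≡k → rim-b≢t (trans (cong rim (toℕ-injective b≡k)) rim-k))
      1+a≤k : suc (toℕ a) ≤ toℕ k
      1+a≤k = subst (_≤ toℕ k) a→b (<⇒≤ b<k)

    leftward-short : ∀ {x y a b} → E x y → x ≡ rim b → y ≡ rim a → RimNext a b →
                     suc (pos x) ≡ pos y
    leftward-short {a = a} {b} e refl refl a→b = begin
      suc (pos (rim b))              ≡⟨ cong suc (pos-rim b) ⟩
      suc (flip (suc (toℕ b)))       ≡⟨ cong (suc ∘ flip ∘ suc) a→b ⟩
      suc (flip (suc (suc (toℕ a)))) ≡⟨ reverseAbove-suc k<1+a 1+a<m ⟩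
      flip (suc (toℕ a))             ≡⟨ pos-rim a ⟨
      pos (rim a)                    ∎
      where
      open ≡-Reasoning
      k<1+a : toℕ k < suc (toℕ a)
      k<1+a = s≤s (leftward-edge-head-≥-t fan rim-k a→b e)
      1+a<m : suc (toℕ a) < m
      1+a<m = subst (_< m) a→b (toℕ<n b)

    short : ∀ {x y} → E x y → x ≢ s → y ≢ t → suc (pos x) ≡ pos y
    short e x≢s y≢t with rim-edge e x≢s
    ... | a , b , a→b , inj₁ (x≡ , y≡) = rightward-short e x≡ y≡ a→b y≢t
    ... | a , b , a→b , inj₂ (x≡ , y≡) = leftward-short e x≡ y≡ a→b

    layout : STLayout E s t
    layout = record { order = order ; pos-s = pos-s ; pos-t = pos-t ; short = short }

    first-spoke-short : ∀ {v i} → v ≡ rim i → toℕ i ≡ 0 → v ≢ t → suc (pos s) ≡ pos v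
    first-spoke-short {i = i} refl i≡0 rim-i≢t = begin
      suc (pos s)        ≡⟨ cong suc pos-s ⟩
      1                  ≡⟨ reverseAbove-≤ (n≢0⇒n>0 k≢0) ⟨
      flip 1             ≡⟨ cong (flip ∘ suc) i≡0 ⟨
      flip (suc (toℕ i)) ≡⟨ pos-rim i ⟨
      pos (rim i)        ∎
      where
      open ≡-Reasoning
      k≢0 : toℕ k ≢ 0
      k≢0 k≡0 = rim-i≢t (trans (cong rim (toℕ-injective (trans i≡0 (sym k≡0)))) rim-k)

lemma3 : ∀ {N : ℕ} (E : Digraph N) (s t : Fin N) (F : IsSTFan E s t)
         (u v : Fin N) → OuterEdge F u v → ¬ (u ≡ s × v ≡ t) →
         Σ (UpwardBookEmbedding E 2) λ B → IsConsecutive s t B u v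
lemma3 E s t F u v (e , outer) not-st = from-outer-edge e outer not-st
  where
  open IsSTFan F
  open FanWithApex fan

  k : Fin m
  k = proj₁ (covers t (Rim.t≢s stdag fan))

  rim-k : rim k ≡ t
  rim-k = proj₂ (covers t (Rim.t≢s stdag fan))

  rim² : ∀ i → rim i ≡ rim (opposite (opposite i))
  rim² = opposite²-invariant rim

  module Forward  = Layout stdag fan rim-k
  module Backward = Layout stdag (reverseFan fan) {opposite k} (trans (sym (rim² k)) rim-k)

  from-outer-edge : ∀ {u v} → E u v → FanOuterAdj s rim u v → ¬ (u ≡ s × v ≡ t) →
                    HasConsecutiveEmbedding E s t u v
  from-outer-edge e (inj₁ (refl , i , inj₁ i≡0 , v≡)) not-st =
    consecutiveEmbedding stdag Forward.layout
      (Forward.first-spoke-short v≡ i≡0 (not-st ∘ (refl ,_)))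
  from-outer-edge e (inj₁ (refl , i , inj₂ i-last , v≡)) not-st =
    consecutiveEmbedding stdag Backward.layout
      (Backward.first-spoke-short (trans v≡ (rim² i)) opposite-i≡0 (not-st ∘ (refl ,_)))
    where
    opposite-i≡0 : toℕ (opposite i) ≡ 0
    opposite-i≡0 = trans (opposite-prop i)
      (trans (cong (_∸ suc (toℕ i)) (sym i-last)) (n∸n≡0 (suc (toℕ i))))
  from-outer-edge e (inj₂ (inj₁ (refl , _))) _ = ⊥-elim (source-s stdag _ e)
  from-outer-edge {v = v} e (inj₂ (inj₂ (i , j , i→j , inj₁ (u≡ , v≡)))) _ with v ≟ᶠ t
  ... | no v≢t = consecutiveEmbedding stdag Forward.layout
    (Forward.rightward-short e u≡ v≡ i→j v≢t)
  ... | yes _  = consecutiveEmbedding stdag Backward.layout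
    (Backward.leftward-short e (trans u≡ (rim² i)) (trans v≡ (rim² j)) (RimNext-opposite i→j))
  from-outer-edge e (inj₂ (inj₂ (i , j , i→j , inj₂ (u≡ , v≡)))) _ =
    consecutiveEmbedding stdag Forward.layout (Forward.leftward-short e u≡ v≡ i→j)
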